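{- Let $S_0=(s_{i,j})_{1\le i,j\le 3}$ be a $3\times 3$ array whose entries are $1,\ldots,9$, each used exactly once, and let $X:=\{s_{1,2},s_{1,3},s_{2,1},s_{2,3},s_{3,1},s_{3,2}\}$. For $c\in\mathbb{Z}\setminus\{0\}$ let $S_c$ denote the array obtained from $S_0$ by keeping the diagonal and replacing $s_{1,2},s_{1,3},s_{2,1},s_{2,3},s_{3,1},s_{3,2}$ by $s_{1,2}+c,\ s_{1,3}-c,\ s_{2,1}-c,\ s_{2,3}+c,\ s_{3,1}+c,\ s_{3,2}-c$ respectively. Let $a,b\in\mathbb{Z}\setminus\{0\}$ with $a\neq b$ such that \[ \{s_{1,2}+c,\ s_{1,3}-c,\ s_{2,1}-c,\ s_{2,3}+c,\ s_{3,1}+c,\ s_{3,2}-c\}=X \quad\text{for both } c=a \text{ and } c=b. \] Then $\mathcal{T}_a\neq\mathcal{T}_b$.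
   Context: For $c\in\mathbb{Z}\setminus\{0\}$, the triplet $\mathcal{T}_c$ associated to $c$ and $S_0$ is, when it exists, the unique set $\{y_1,y_2,y_3\}\subseteq X$ with $y_1<y_2<y_3$ such that $\{y_1,y_1+c,y_2,y_2+c,y_3,y_3+c\}=X$. (Under the displayed set equality for $c$, this triplet exists and is unique.) -}

module Defs where

open import Data.Fin using (Fin; zero; suc)
open import Data.Integer using (ℤ; +_; _+_; _-_; _≤_; _<_)
open import Data.List using (List; []; _∷_)
open import Data.List.Membership.Propositional using (_∈_)
open import Data.Product using (_×_)
open import Relation.Binary.PropositionalEquality using (_≡_)

-- A 3×3 array, indices 0,1,2 (paper's 1,2,3).
Array : Set
Array = Fin 3 → Fin 3 → ℤ

pattern i1 = zero
pattern i2 = suc zero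
pattern i3 = suc (suc zero)

-- Entries are 1,…,9, each used exactly once (9 cells, injective into {1..9}).
IsPermArray : Array → Set
IsPermArray s =
  (∀ i j → (+ 1 ≤ s i j) × (s i j ≤ + 9)) ×
  (∀ i j k l → s i j ≡ s k l → (i ≡ k) × (j ≡ l))

_≈set_ : List ℤ → List ℤ → Set
xs ≈set ys = ∀ z → ((z ∈ xs → z ∈ ys) × (z ∈ ys → z ∈ xs))

Xof : Array → List ℤ
Xof s = s i1 i2 ∷ s i1 i3 ∷ s i2 i1 ∷ s i2 i3 ∷ s i3 i1 ∷ s i3 i2 ∷ []

Xshift : Array → ℤ → List ℤ
Xshift s c = (s i1 i2 + c) ∷ (s i1 i3 - c) ∷ (s i2 i1 - c) ∷
             (s i2 i3 + c) ∷ (s i3 i1 + c) ∷ (s i3 i2 - c) ∷ []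

-- (y1,y2,y3) is the triplet T_c associated to c and S_0:
-- {y1,y2,y3} ⊆ X, y1<y2<y3, {y1,y1+c,y2,y2+c,y3,y3+c} = X.
IsTriplet : Array → ℤ → ℤ → ℤ → ℤ → Set
IsTriplet s c y1 y2 y3 =
  (y1 ∈ Xof s) × (y2 ∈ Xof s) × (y3 ∈ Xof s) ×
  (y1 < y2) × (y2 < y3) ×
  ((y1 ∷ (y1 + c) ∷ y2 ∷ (y2 + c) ∷ y3 ∷ (y3 + c) ∷ []) ≈set Xof s)

-- The six entries of X are distinct, so in {y₁, y₁+c, y₂, y₂+c, y₃, y₃+c} = X the six listed
-- values are distinct; in particular y₁ + c is none of y₁, y₂, y₃. If the same triplet served
-- both a and b, then y₁ + a ∈ X would have to be some yᵢ + b with yᵢ ≥ y₁, giving b ≤ a; by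
-- symmetry a ≤ b, so a = b.
module Submission where

open import Defs
open import Data.Integer using (ℤ; +_)
open import Data.Product using (_×_)
open import Relation.Binary.PropositionalEquality using (_≡_; _≢_)
open import Relation.Nullary using (¬_)

open import Data.Empty using (⊥-elim)
open import Data.Fin using (Fin)
open import Data.Fin.Properties using () renaming (_≟_ to _≟ᶠ_)
open import Data.Integer using (_+_; _≤_)
open import Data.Integer.Properties
  using (≤-refl; ≤-reflexive; ≤-trans; ≤-antisym; <⇒≤; <-trans; +-monoˡ-≤; +-0-abelianGroup)
open import Algebra.Properties.AbelianGroup +-0-abelianGroup using (∙-cancelˡ)
open import Data.List using (List; []; _∷_; length; removeAt)
open import Data.List.Properties using (length-removeAt′)
open import Data.List.Membership.Propositional using (_∈_; _∉_)
open import Data.List.Relation.Binary.Subset.Propositional using (_⊆_)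
open import Data.List.Relation.Binary.Subset.Propositional.Properties using (xs⊆x∷xs; ∈-∷⁺ʳ)
open import Data.List.Relation.Unary.All as All using ()
open import Data.List.Relation.Unary.AllPairs using (_∷_)
open import Data.List.Relation.Unary.Any using (here; there; _─_)
open import Data.List.Relation.Unary.Unique.Propositional using (Unique)
import Data.List.Relation.Unary.Unique.Propositional.Properties as Unique
open import Data.Nat as ℕ using (s≤s; z≤n)
import Data.Nat.Properties as ℕ
open import Data.Product using (_,_; proj₁; proj₂; uncurry)
open import Data.Product.Properties using (≡-dec; ×-≡,≡→≡)
open import Data.List.Relation.Unary.Unique.DecPropositional (≡-dec (_≟ᶠ_ {3}) (_≟ᶠ_ {3}))
  using (unique?)
open import Function using (_∘_)
open import Relation.Binary.PropositionalEquality using (refl; sym)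
open import Relation.Nullary.Decidable using (from-yes)

module _ {a} {A : Set a} where

  ∈-─ : ∀ {x y : A} {ys} (x∈ys : x ∈ ys) → y ∈ ys → y ≢ x → y ∈ (ys ─ x∈ys)
  ∈-─ (here refl) (here refl) y≢x = ⊥-elim (y≢x refl)
  ∈-─ (here refl) (there y∈ys) _  = y∈ys
  ∈-─ (there _)   (here refl)  _  = here refl
  ∈-─ (there x∈ys) (there y∈ys) y≢x = there (∈-─ x∈ys y∈ys y≢x)

  unique-⊆⇒length≤ : ∀ {xs ys : List A} → Unique xs → xs ⊆ ys → length xs ℕ.≤ length ys
  unique-⊆⇒length≤ {[]} _ _ = z≤n
  unique-⊆⇒length≤ {x ∷ xs} {ys} (x≢xs ∷ xs-unique) x∷xs⊆ys = begin
    ℕ.suc (length xs)                  ≤⟨ s≤s (unique-⊆⇒length≤ xs-unique xs⊆ys─x) ⟩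
    ℕ.suc (length (removeAt ys _))     ≡⟨ sym (length-removeAt′ ys _) ⟩
    length ys                          ∎
    where
    open ℕ.≤-Reasoning
    x∈ys : x ∈ ys
    x∈ys = x∷xs⊆ys (here refl)
    xs⊆ys─x : xs ⊆ (ys ─ x∈ys)
    xs⊆ys─x y∈xs = ∈-─ x∈ys (x∷xs⊆ys (there y∈xs)) (λ y≡x → All.lookup x≢xs y∈xs (sym y≡x))

offDiagonal : List (Fin 3 × Fin 3)
offDiagonal = (i1 , i2) ∷ (i1 , i3) ∷ (i2 , i1) ∷ (i2 , i3) ∷ (i3 , i1) ∷ (i3 , i2) ∷ []

entries-injective : ∀ {s} → IsPermArray s → ∀ {p q} → uncurry s p ≡ uncurry s q → p ≡ q
entries-injective (_ , s-injective) {i , j} {k , l} = ×-≡,≡→≡ ∘ s-injective i j k l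

-- Xof s is definitionally map (uncurry s) offDiagonal.
Xof-unique : ∀ {s} → IsPermArray s → Unique (Xof s)
Xof-unique P = Unique.map⁺ (entries-injective P) (from-yes (unique? offDiagonal))

-- Otherwise X would fit into five values, and the length bound would read 6 ≤ 5.
shift-∉ : ∀ {s c y1 y2 y3} → IsPermArray s → IsTriplet s c y1 y2 y3 →
          y1 + c ∉ y1 ∷ y2 ∷ (y2 + c) ∷ y3 ∷ (y3 + c) ∷ []
shift-∉ {c = c} {y1} {y2} {y3} P (_ , _ , _ , _ , _ , covers) y1+c∈rest =
  ℕ.<-irrefl refl (unique-⊆⇒length≤ (Xof-unique P) (drop-shift ∘ λ x∈X → proj₂ (covers _) x∈X))
  where
  rest : List ℤ
  rest = y2 ∷ (y2 + c) ∷ y3 ∷ (y3 + c) ∷ []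
  drop-shift : y1 ∷ (y1 + c) ∷ rest ⊆ y1 ∷ rest
  drop-shift = ∈-∷⁺ʳ (here refl) (∈-∷⁺ʳ y1+c∈rest (xs⊆x∷xs rest y1))

shift-≤ : ∀ {y w a b : ℤ} → y ≤ w → y + a ≡ w + b → y + b ≤ y + a
shift-≤ {b = b} y≤w y+a≡w+b = ≤-trans (+-monoˡ-≤ b y≤w) (≤-reflexive (sym y+a≡w+b))

shared-triplet⇒≤ : ∀ {s a b y1 y2 y3} → IsPermArray s →
                   IsTriplet s a y1 y2 y3 → IsTriplet s b y1 y2 y3 → y1 + b ≤ y1 + a
shared-triplet⇒≤ {a = a} {y1 = y1} P Ta@(_ , _ , _ , _ , _ , a-covers) (_ , _ , _ , y1<y2 , y2<y3 , b-covers)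
  with proj₂ (b-covers (y1 + a)) (proj₁ (a-covers (y1 + a)) (there (here refl)))
... | here eq                                         = ⊥-elim (shift-∉ P Ta (here eq))
... | there (here eq)                                 = shift-≤ (≤-refl {y1}) eq
... | there (there (here eq))                         = ⊥-elim (shift-∉ P Ta (there (here eq)))
... | there (there (there (here eq)))                 = shift-≤ (<⇒≤ y1<y2) eq
... | there (there (there (there (here eq))))         = ⊥-elim (shift-∉ P Ta (there (there (there (here eq)))))
... | there (there (there (there (there (here eq))))) = shift-≤ (<⇒≤ (<-trans y1<y2 y2<y3)) eq

lemma2p5 : (s : Array) → IsPermArray s →
    (a b : ℤ) → a ≢ + 0 → b ≢ + 0 → a ≢ b →
    Xshift s a ≈set Xof s → Xshift s b ≈set Xof s →
    (y1 y2 y3 z1 z2 z3 : ℤ) →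
    IsTriplet s a y1 y2 y3 → IsTriplet s b z1 z2 z3 →
    ¬ ((y1 ≡ z1) × (y2 ≡ z2) × (y3 ≡ z3))
lemma2p5 s P a b _ _ a≢b _ _ y1 y2 y3 _ _ _ Ta Tb (refl , refl , refl) =
  a≢b (∙-cancelˡ y1 a b (≤-antisym (shared-triplet⇒≤ P Tb Ta) (shared-triplet⇒≤ P Ta Tb)))
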